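{- Let $r\geq3$ be odd and $n\geq\frac{r+3}{2}$. If $r\geq7$, then $\det(1;T_{r+2}^{(r)},T_{r+4}^{(r)},\ldots,T_{2n+r}^{(r)})$ equals \begin{itemize} \item $(-1)^{n-q}$ if $n=q(r-1)/2$ for some integer $q$; \item $2\cdot(-1)^{n-1-q}$ if $n-1=q(r-1)/2$ for some integer $q$; \item $(-1)^{n-q}$ if $n-2=q(r-1)/2$ for some integer $q$; \item $0$ otherwise. \end{itemize} If $r=5$, then $\det(1;T_7^{(5)},T_9^{(5)},\ldots,T_{2n+5}^{(5)})$ equals $0$ if $n$ is even and $2\cdot(-1)^{(n-1)/2}$ if $n$ is odd. If $r=3$, then $\det(1;T_5,T_7,\ldots,T_{2n+3})=4$ for all $n\geq3$.
   Context: For $r\ge3$, the generalized $r$-tribonacci numbers are defined by $T_0^{(r)}=\cdots=T_{r-2}^{(r)}=0$, $T_{r-1}^{(r)}=1$, and $T_n^{(r)}=T_{n-1}^{(r)}+T_{n-2}^{(r)}+T_{n-r}^{(r)}$ for $n\geq r$; $T_n=T_n^{(3)}$ are the ordinary tribonacci numbers. For numbers $a_0,\ldots,a_n$, $\det(a_0;a_1,\ldots,a_n)$ denotes the determinant of the $n\times n$ Toeplitz--Hessenberg matrix whose $(i,j)$ entry is $a_{i-j+1}$ if $i-j+1\ge0$ and $0$ otherwise; here the $k$-th entry after the semicolon is $T_{r+2k}^{(r)}$. -}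

module Defs where

open import Data.Nat as ℕ using (ℕ; zero; suc; _∸_; _≤ᵇ_; _≡ᵇ_)
open import Data.Bool using (if_then_else_)
open import Data.List using (List; []; _∷_)
open import Data.Fin using (Fin; zero; suc; toℕ; punchIn)
open import Data.Integer as ℤ using (ℤ; +_; -_)

nth : List ℕ → ℕ → ℕ
nth []       _       = 0
nth (x ∷ xs) zero    = x
nth (x ∷ xs) (suc k) = nth xs k

-- next value T_n given n and the reversed history [T_{n-1}, ..., T_0]
step : ℕ → ℕ → List ℕ → ℕ
step r n prev =
  if n ℕ.<ᵇ r ∸ 1 then 0
  else if n ≡ᵇ (r ∸ 1) then 1
  else nth prev 0 ℕ.+ nth prev 1 ℕ.+ nth prev (r ∸ 1)

hist : ℕ → ℕ → List ℕ
hist r zero    = []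
hist r (suc n) = step r n (hist r n) ∷ hist r n

-- generalized r-tribonacci numbers T_n^{(r)}:
-- T_0 = ... = T_{r-2} = 0, T_{r-1} = 1, T_n = T_{n-1} + T_{n-2} + T_{n-r} (n ≥ r)
T : ℕ → ℕ → ℕ
T r n = step r n (hist r n)

sumFin : (n : ℕ) → (Fin n → ℤ) → ℤ
sumFin zero    f = + 0
sumFin (suc n) f = f zero ℤ.+ sumFin n (λ i → f (suc i))

det : (n : ℕ) → (Fin n → Fin n → ℤ) → ℤ
det zero    M = + 1
det (suc n) M =
  sumFin (suc n) (λ j → ((- + 1) ℤ.^ toℕ j) ℤ.* (M zero j ℤ.* det n (λ i k → M (suc i) (punchIn j k))))

toeplitzHessenberg : (n : ℕ) → (ℕ → ℤ) → Fin n → Fin n → ℤ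
toeplitzHessenberg n a i j =
  if toℕ j ≤ᵇ suc (toℕ i) then a (suc (toℕ i) ∸ toℕ j) else + 0

detTH : (n : ℕ) → (ℕ → ℤ) → ℤ
detTH n a = det n (toeplitzHessenberg n a)

seqA : ℕ → ℕ → ℤ
seqA r zero    = + 1
seqA r (suc k) = + T r (r ℕ.+ 2 ℕ.* suc k)

D : ℕ → ℕ → ℤ
D r n = detTH n (seqA r)

module Submission where

open import Defs
open import Data.Nat using (ℕ; _+_; _*_; _∸_; _≤_; _%_)
open import Data.Integer using (ℤ; +_; -_; _^_) renaming (_*_ to _*ℤ_)
open import Data.Product using (_×_; ∃)
open import Relation.Nullary using (¬_)
open import Relation.Binary.PropositionalEquality using (_≡_)

open import Data.Bool using (true; false; if_then_else_)
import Data.Bool as Bool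
open import Data.Empty using (⊥-elim)
open import Data.Fin using (Fin; toℕ; punchIn) renaming (zero to fzero; suc to fsuc)
open import Data.Integer using () renaming (_+_ to _+ᶻ_)
import Data.Integer.Properties as ℤP
open import Data.Integer.Tactic.RingSolver using (solve-∀)
open import Data.List using (List; []; _∷_)
open import Data.Nat using (zero; suc; _<_; z≤n; s≤s; _≟_; _≤?_; _<ᵇ_; _≤ᵇ_; _≡ᵇ_; NonZero; >-nonZero)
open import Data.Nat.DivMod using (_/_; m≡m%n+[m/n]*n; m%n<n)
open import Data.Nat.Induction using (<-rec)
import Data.Nat.Properties as ℕP
import Data.Nat.Tactic.RingSolver as ℕSolver
open import Data.Product using (_,_)
open import Data.Unit using (tt)
open import Relation.Binary using (tri<; tri≈; tri>)
open import Relation.Binary.PropositionalEquality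
  using (refl; sym; trans; cong; cong₂; subst; module ≡-Reasoning)
open import Relation.Nullary using (yes; no; Dec)

-- Sequences ℕ → ℤ are treated as formal power series: finite sums Σ<, the Cauchy product _⊛_,
-- the shift x^j · g and polynomials given by lists of terms.  For any sequence a with a 0 = 1,
-- Laplace expansion of the Toeplitz–Hessenberg matrix shows that the signed determinants
-- (-1)^n det(a 0; a 1, …, a n) are the coefficients of 1 / Σ a k x^k.  The tribonacci series
-- τ(x) = Σ T n x^n satisfies (1 - x - x² - x^r) τ(x) = x^(r-1); multiplying by 1 + x - x² + x^r
-- leaves only even powers of x on the left, and for odd r its even part reads
-- A(x) (1 - 3x + x² - 2x^(m+1) - x^r) = 1 + x^m with A(x) = Σ T (r + 2k) x^k.  Hence the signed
-- determinants are the coefficients of P(x) / (1 + x^m) for that numerator P, i.e. they obey the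
-- recurrence signedΔ (m + x) = P (m + x) - signedΔ x with initial values P j (j < m).
-- Solving it block by block, n = q m + j, gives the case r ≥ 7; for r = 3 and r = 5 the
-- recurrence is iterated directly.

Σ< : ℕ → (ℕ → ℤ) → ℤ
Σ< zero    f = + 0
Σ< (suc n) f = f 0 +ᶻ Σ< n (λ k → f (suc k))

Σ<-cong : ∀ n {f g : ℕ → ℤ} → (∀ k → k < n → f k ≡ g k) → Σ< n f ≡ Σ< n g
Σ<-cong zero    eq = refl
Σ<-cong (suc n) eq = cong₂ _+ᶻ_ (eq 0 (s≤s z≤n)) (Σ<-cong n (λ k k<n → eq (suc k) (s≤s k<n)))

Σ<-zero : ∀ n (f : ℕ → ℤ) → (∀ k → k < n → f k ≡ + 0) → Σ< n f ≡ + 0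
Σ<-zero n f eq = trans (Σ<-cong n eq) (zeros n)
  where
  zeros : ∀ n → Σ< n (λ _ → + 0) ≡ + 0
  zeros zero    = refl
  zeros (suc n) = trans (ℤP.+-identityˡ _) (zeros n)

Σ<-+ : ∀ n (f g : ℕ → ℤ) → Σ< n (λ k → f k +ᶻ g k) ≡ Σ< n f +ᶻ Σ< n g
Σ<-+ zero    f g = refl
Σ<-+ (suc n) f g rewrite Σ<-+ n (λ k → f (suc k)) (λ k → g (suc k)) = swap (f 0) (g 0) _ _
  where
  swap : ∀ a b c d → (a +ᶻ b) +ᶻ (c +ᶻ d) ≡ (a +ᶻ c) +ᶻ (b +ᶻ d)
  swap = solve-∀

Σ<-* : ∀ n c (f : ℕ → ℤ) → Σ< n (λ k → c *ℤ f k) ≡ c *ℤ Σ< n f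
Σ<-* zero    c f = sym (ℤP.*-zeroʳ c)
Σ<-* (suc n) c f rewrite Σ<-* n c (λ k → f (suc k)) = sym (ℤP.*-distribˡ-+ c (f 0) _)

Σ<-extend : ∀ p q (f : ℕ → ℤ) → (∀ k → p ≤ k → k < p + q → f k ≡ + 0) → Σ< (p + q) f ≡ Σ< p f
Σ<-extend zero    q f eq = Σ<-zero q f (λ k k<q → eq k z≤n k<q)
Σ<-extend (suc p) q f eq =
  cong (f 0 +ᶻ_) (Σ<-extend p q (λ k → f (suc k)) (λ k p≤k k<p+q → eq (suc k) (s≤s p≤k) (s≤s k<p+q)))

δ : ℕ → ℕ → ℤ
δ a b with a ≟ b
... | yes _ = + 1
... | no _  = + 0

δ-yes : ∀ {a b} → a ≡ b → δ a b ≡ + 1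
δ-yes {a} {b} eq with a ≟ b
... | yes _  = refl
... | no a≢b = ⊥-elim (a≢b eq)

δ-no : ∀ {a b} → ¬ a ≡ b → δ a b ≡ + 0
δ-no {a} {b} a≢b with a ≟ b
... | yes eq = ⊥-elim (a≢b eq)
... | no _   = refl

δ-< : ∀ {a} b → b < a → δ a b ≡ + 0
δ-< b b<a = δ-no (λ eq → ℕP.<-irrefl (sym eq) b<a)

δ-+ : ∀ k a b → δ (k + a) (k + b) ≡ δ a b
δ-+ k a b with a ≟ b
... | yes refl = δ-yes refl
... | no a≢b   = δ-no (λ eq → a≢b (ℕP.+-cancelˡ-≡ k a b eq))

δ-double : ∀ a b → δ (2 * a) (2 * b) ≡ δ a b
δ-double a b with a ≟ b
... | yes refl = δ-yes refl
... | no a≢b   = δ-no (λ eq → a≢b (ℕP.*-cancelˡ-≡ a b 2 eq))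

δ-even-1 : ∀ a → δ (2 * a) 1 ≡ + 0
δ-even-1 a = δ-no (even≢1 a)
  where
  even≢1 : ∀ a → ¬ 2 * a ≡ 1
  even≢1 (suc a) eq = ℕP.m+1+n≢0 a (ℕP.suc-injective eq)

-- shift j g is the sequence of x^j · g(x): (shift j g) n = g (n - j), or 0 when n < j.
shift : ℕ → (ℕ → ℤ) → ℕ → ℤ
shift j g n with j ≤? n
... | yes _ = g (n ∸ j)
... | no _  = + 0

shift-≤ : ∀ {j n} (g : ℕ → ℤ) → j ≤ n → shift j g n ≡ g (n ∸ j)
shift-≤ {j} {n} g j≤n with j ≤? n
... | yes _  = refl
... | no j≰n = ⊥-elim (j≰n j≤n)

shift-≰ : ∀ {j n} (g : ℕ → ℤ) → ¬ j ≤ n → shift j g n ≡ + 0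
shift-≰ {j} {n} g j≰n with j ≤? n
... | yes j≤n = ⊥-elim (j≰n j≤n)
... | no _    = refl

shift-cong : ∀ j {g h : ℕ → ℤ} → (∀ i → g i ≡ h i) → ∀ n → shift j g n ≡ shift j h n
shift-cong j eq n with j ≤? n
... | yes _ = eq (n ∸ j)
... | no _  = refl

shift-+ : ∀ (g : ℕ → ℤ) j i n → shift (j + i) g (j + n) ≡ shift i g n
shift-+ g j i n with i ≤? n
... | yes i≤n = trans (shift-≤ g (ℕP.+-monoʳ-≤ j i≤n)) (cong g (ℕP.[m+n]∸[m+o]≡n∸o j n i))
... | no i≰n  = shift-≰ g (λ le → i≰n (ℕP.+-cancelˡ-≤ j i n le))

shift-δ : ∀ j n → shift j (λ i → δ i 0) n ≡ δ n j
shift-δ j n with j ≤? n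
... | yes j≤n = trans (sym (δ-+ j (n ∸ j) 0))
                      (cong₂ δ (ℕP.m+[n∸m]≡n j≤n) (ℕP.+-identityʳ j))
... | no j≰n  = sym (δ-no (λ eq → j≰n (ℕP.≤-reflexive (sym eq))))

_⊛_ : (ℕ → ℤ) → (ℕ → ℤ) → ℕ → ℤ
(f ⊛ g) n = Σ< (suc n) (λ k → f k *ℤ g (n ∸ k))

⊛-+ : ∀ f g h n → (f ⊛ (λ i → g i +ᶻ h i)) n ≡ (f ⊛ g) n +ᶻ (f ⊛ h) n
⊛-+ f g h n =
  trans (Σ<-cong (suc n) (λ k _ → ℤP.*-distribˡ-+ (f k) (g (n ∸ k)) (h (n ∸ k)))) (Σ<-+ (suc n) (λ k → f k *ℤ g (n ∸ k)) (λ k → f k *ℤ h (n ∸ k)))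

⊛-scale : ∀ f c g n → (f ⊛ (λ i → c *ℤ g i)) n ≡ c *ℤ (f ⊛ g) n
⊛-scale f c g n = trans (Σ<-cong (suc n) (λ k _ → reorder (f k) c (g (n ∸ k)))) (Σ<-* (suc n) c (λ k → f k *ℤ g (n ∸ k)))
  where
  reorder : ∀ x c y → x *ℤ (c *ℤ y) ≡ c *ℤ (x *ℤ y)
  reorder = solve-∀

shift-step : ∀ e n (g : ℕ → ℤ) → shift e g (suc n) ≡ g 0 *ℤ δ (suc n) e +ᶻ shift e (λ k → g (suc k)) n
shift-step e n g with ℕP.<-cmp e (suc n)
... | tri< (s≤s e≤n) _ _ = begin
    shift e g (suc n)                                   ≡⟨ shift-≤ g (ℕP.m≤n⇒m≤1+n e≤n) ⟩
    g (suc n ∸ e)                                       ≡⟨ cong g (ℕP.+-∸-assoc 1 e≤n) ⟩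
    g (suc (n ∸ e))                                     ≡⟨ sym (shift-≤ (λ k → g (suc k)) e≤n) ⟩
    shift e (λ k → g (suc k)) n                         ≡⟨ sym (ℤP.+-identityˡ _) ⟩
    + 0 +ᶻ shift e (λ k → g (suc k)) n                  ≡⟨ cong (_+ᶻ shift e (λ k → g (suc k)) n) (sym (trans (cong (g 0 *ℤ_) (δ-< e (s≤s e≤n))) (ℤP.*-zeroʳ (g 0)))) ⟩
    g 0 *ℤ δ (suc n) e +ᶻ shift e (λ k → g (suc k)) n   ∎
  where open ≡-Reasoning
... | tri≈ _ refl _ = begin
    shift (suc n) g (suc n)                                   ≡⟨ shift-≤ g (ℕP.≤-refl {suc n}) ⟩
    g (suc n ∸ suc n)                                         ≡⟨ cong g (ℕP.n∸n≡0 (suc n)) ⟩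
    g 0                                                       ≡⟨ sym (ℤP.*-identityʳ (g 0)) ⟩
    g 0 *ℤ + 1                                                ≡⟨ cong (g 0 *ℤ_) (sym (δ-yes refl)) ⟩
    g 0 *ℤ δ (suc n) (suc n)                                  ≡⟨ sym (ℤP.+-identityʳ _) ⟩
    g 0 *ℤ δ (suc n) (suc n) +ᶻ + 0                           ≡⟨ cong (g 0 *ℤ δ (suc n) (suc n) +ᶻ_) (sym (shift-≰ (λ k → g (suc k)) (ℕP.<⇒≱ (ℕP.n<1+n n)))) ⟩
    g 0 *ℤ δ (suc n) (suc n) +ᶻ shift (suc n) (λ k → g (suc k)) n ∎
  where open ≡-Reasoning
... | tri> _ _ n<e =
  trans (shift-≰ g (ℕP.<⇒≱ n<e))
    (sym (cong₂ _+ᶻ_ (trans (cong (g 0 *ℤ_) (δ-no (ℕP.<⇒≢ n<e))) (ℤP.*-zeroʳ (g 0)))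
                     (shift-≰ (λ k → g (suc k)) (λ e≤n → ℕP.<⇒≱ n<e (ℕP.m≤n⇒m≤1+n e≤n)))))

⊛-δ : ∀ f e n → (f ⊛ (λ i → δ i e)) n ≡ shift e f n
⊛-δ f e zero with e ≤? 0
... | yes e≤0 rewrite ℕP.n≤0⇒n≡0 e≤0 = trans (ℤP.+-identityʳ _) (ℤP.*-identityʳ (f 0))
... | no e≰0  = trans (ℤP.+-identityʳ _)
                  (trans (cong (f 0 *ℤ_) (δ-no (λ eq → e≰0 (ℕP.≤-reflexive (sym eq)))))
                    (ℤP.*-zeroʳ (f 0)))
⊛-δ f e (suc n) = trans (cong (f 0 *ℤ δ (suc n) e +ᶻ_) (⊛-δ (λ k → f (suc k)) e n)) (sym (shift-step e n f))

⊛-shift-+ : ∀ f j g n → (f ⊛ shift j g) (n + j) ≡ (f ⊛ g) n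
⊛-shift-+ f j g n = trans (Σ<-extend (suc n) j term tail-vanishes) (Σ<-cong (suc n) head-matches)
  where
  term : ℕ → ℤ
  term k = f k *ℤ shift j g (n + j ∸ k)
  -- for n < k the term only sees the zero prefix of x^j g
  tail-vanishes : ∀ k → suc n ≤ k → k < suc n + j → term k ≡ + 0
  tail-vanishes k n<k (s≤s k≤n+j) = trans (cong (f k *ℤ_) (shift-≰ g below-j)) (ℤP.*-zeroʳ (f k))
    where
    below-j : ¬ j ≤ n + j ∸ k
    below-j j≤ = ℕP.<⇒≱ n<k (ℕP.+-cancelʳ-≤ j k n
                   (subst (_≤ n + j) (ℕP.+-comm j k) (ℕP.m≤o∸n⇒m+n≤o j k≤n+j j≤)))
  head-matches : ∀ k → k < suc n → term k ≡ f k *ℤ g (n ∸ k)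
  head-matches k (s≤s k≤n) =
    cong (f k *ℤ_) (trans (cong (shift j g) (ℕP.+-∸-comm j k≤n))
                          (trans (shift-≤ g (ℕP.m≤n+m j (n ∸ k))) (cong g (ℕP.m+n∸n≡m (n ∸ k) j))))

⊛-shift : ∀ f j g n → (f ⊛ shift j g) n ≡ shift j (f ⊛ g) n
⊛-shift f j g n = by-cases (j ≤? n)
  where
  by-cases : Dec (j ≤ n) → (f ⊛ shift j g) n ≡ shift j (f ⊛ g) n
  by-cases (yes j≤n) = begin
    (f ⊛ shift j g) n              ≡⟨ cong (f ⊛ shift j g) (sym (ℕP.m∸n+n≡m j≤n)) ⟩
    (f ⊛ shift j g) (n ∸ j + j)    ≡⟨ ⊛-shift-+ f j g (n ∸ j) ⟩
    (f ⊛ g) (n ∸ j)                ≡⟨ sym (shift-≤ (f ⊛ g) j≤n) ⟩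
    shift j (f ⊛ g) n              ∎
    where open ≡-Reasoning
  by-cases (no j≰n) = trans (Σ<-zero (suc n) _ vanishes) (sym (shift-≰ (f ⊛ g) j≰n))
    where
    vanishes : ∀ k → k < suc n → f k *ℤ shift j g (n ∸ k) ≡ + 0
    vanishes k _ = trans (cong (f k *ℤ_) (shift-≰ g (λ j≤ → j≰n (ℕP.≤-trans j≤ (ℕP.m∸n≤m n k)))))
                         (ℤP.*-zeroʳ (f k))

∸-suc-< : ∀ k n → k < n → n ∸ suc k < n
∸-suc-< k (suc n) _ = s≤s (ℕP.m∸n≤m n k)

⊛-cancel : ∀ f v → f 0 ≡ + 1 → (∀ n → (f ⊛ v) n ≡ + 0) → ∀ n → v n ≡ + 0
⊛-cancel f v f0≡1 fv≡0 = <-rec (λ n → v n ≡ + 0) by-induction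
  where
  by-induction : ∀ n → (∀ {i} → i < n → v i ≡ + 0) → v n ≡ + 0
  by-induction n ih = begin
    v n                                                     ≡⟨ sym (ℤP.*-identityˡ (v n)) ⟩
    + 1 *ℤ v n                                              ≡⟨ sym (ℤP.+-identityʳ _) ⟩
    + 1 *ℤ v n +ᶻ + 0                                       ≡⟨ cong₂ (λ c s → c *ℤ v n +ᶻ s) (sym f0≡1) (sym (Σ<-zero n _ earlier)) ⟩
    f 0 *ℤ v n +ᶻ Σ< n (λ k → f (suc k) *ℤ v (n ∸ suc k))   ≡⟨ fv≡0 n ⟩
    + 0                                                     ∎
    where
    open ≡-Reasoning
    earlier : ∀ k → k < n → f (suc k) *ℤ v (n ∸ suc k) ≡ + 0
    earlier k k<n = trans (cong (f (suc k) *ℤ_) (ih (∸-suc-< k n k<n)))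
                          (ℤP.*-zeroʳ (f (suc k)))

-- A polynomial Σ c · x^e, given by its list of terms (c , e), as a coefficient sequence.
poly : List (ℤ × ℕ) → ℕ → ℤ
poly []             i = + 0
poly ((c , e) ∷ ts) i = c *ℤ δ i e +ᶻ poly ts i

act : List (ℤ × ℕ) → (ℕ → ℤ) → ℕ → ℤ
act []             g n = + 0
act ((c , e) ∷ ts) g n = c *ℤ shift e g n +ᶻ act ts g n

⊛-poly : ∀ f ts n → (f ⊛ poly ts) n ≡ act ts f n
⊛-poly f []             n = Σ<-zero (suc n) _ (λ k _ → ℤP.*-zeroʳ (f k))
⊛-poly f ((c , e) ∷ ts) n = begin
  (f ⊛ poly ((c , e) ∷ ts)) n                           ≡⟨ ⊛-+ f (λ i → c *ℤ δ i e) (poly ts) n ⟩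
  (f ⊛ (λ i → c *ℤ δ i e)) n +ᶻ (f ⊛ poly ts) n        ≡⟨ cong₂ _+ᶻ_ (⊛-scale f c (λ i → δ i e) n) (⊛-poly f ts n) ⟩
  c *ℤ (f ⊛ (λ i → δ i e)) n +ᶻ act ts f n             ≡⟨ cong (λ x → c *ℤ x +ᶻ act ts f n) (⊛-δ f e n) ⟩
  c *ℤ shift e f n +ᶻ act ts f n                        ∎
  where open ≡-Reasoning

sign : ℕ → ℤ
sign k = (- + 1) ^ k

sign-square : ∀ k → sign k *ℤ sign k ≡ + 1
sign-square zero    = refl
sign-square (suc k) = trans (squares-agree (sign k)) (sign-square k)
  where
  squares-agree : ∀ x → ((- + 1) *ℤ x) *ℤ ((- + 1) *ℤ x) ≡ x *ℤ x
  squares-agree = solve-∀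

sign-split : ∀ {i n} → i ≤ n → sign n ≡ sign i *ℤ sign (n ∸ i)
sign-split {i} {n} i≤n = trans (cong sign (sym (ℕP.m+[n∸m]≡n i≤n))) (ℤP.^-distribˡ-+-* (- + 1) i (n ∸ i))

sign-∸ : ∀ {q n} → q ≤ n → sign (n ∸ q) ≡ sign n *ℤ sign q
sign-∸ {q} {n} q≤n = begin
  sign (n ∸ q)                                   ≡⟨ sym (ℤP.*-identityˡ _) ⟩
  + 1 *ℤ sign (n ∸ q)                            ≡⟨ cong (_*ℤ sign (n ∸ q)) (sym (sign-square q)) ⟩
  (sign q *ℤ sign q) *ℤ sign (n ∸ q)             ≡⟨ regroup (sign q) (sign (n ∸ q)) ⟩
  (sign q *ℤ sign (n ∸ q)) *ℤ sign q             ≡⟨ cong (_*ℤ sign q) (sym (sign-split q≤n)) ⟩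
  sign n *ℤ sign q                               ∎
  where
  open ≡-Reasoning
  regroup : ∀ s t → (s *ℤ s) *ℤ t ≡ (s *ℤ t) *ℤ s
  regroup = solve-∀

sumFin-cong : ∀ n {f g : Fin n → ℤ} → (∀ j → f j ≡ g j) → sumFin n f ≡ sumFin n g
sumFin-cong zero    eq = refl
sumFin-cong (suc n) eq = cong₂ _+ᶻ_ (eq fzero) (sumFin-cong n (λ j → eq (fsuc j)))

sumFin-zero : ∀ n (f : Fin n → ℤ) → (∀ j → f j ≡ + 0) → sumFin n f ≡ + 0
sumFin-zero zero    f eq = refl
sumFin-zero (suc n) f eq rewrite eq fzero | sumFin-zero n (λ j → f (fsuc j)) (λ j → eq (fsuc j)) = refl

det-cong : ∀ n (M M′ : Fin n → Fin n → ℤ) → (∀ i j → M i j ≡ M′ i j) → det n M ≡ det n M′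
det-cong zero    M M′ eq = refl
det-cong (suc n) M M′ eq = sumFin-cong (suc n) λ j →
  cong₂ (λ x y → ((- + 1) ^ toℕ j) *ℤ (x *ℤ y)) (eq fzero j)
        (det-cong n _ _ (λ i k → eq (fsuc i) (punchIn j k)))

<ᵇ-suc : ∀ k x → (k <ᵇ suc x) ≡ (k ≤ᵇ x)
<ᵇ-suc zero    x = refl
<ᵇ-suc (suc k) x = refl

module ToeplitzHessenberg (a : ℕ → ℤ) (a0≡1 : a 0 ≡ + 1) where

  H : (n : ℕ) → Fin n → Fin n → ℤ
  H n = toeplitzHessenberg n a

  Δ : ℕ → ℤ
  Δ n = detTH n a

  H-minor : ∀ {n} (i k : Fin n) → H (suc n) (fsuc i) (fsuc k) ≡ H n i k
  H-minor i k = cong (λ b → if b then a (suc (toℕ i) ∸ toℕ k) else + 0) (<ᵇ-suc (toℕ k) (suc (toℕ i)))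

  -- H n with its first column replaced by β (H n itself has first column a 1, a 2, …).
  withColumn : (n : ℕ) → (ℕ → ℤ) → Fin n → Fin n → ℤ
  withColumn n β i fzero    = β (toℕ i)
  withColumn n β i (fsuc j) = H n i (fsuc j)

  -- Laplace expansion along the first row, which is (β 0, a 0, 0, …, 0) = (β 0, 1, 0, …, 0).
  expand-first-row : ∀ n β → det (suc (suc n)) (withColumn (suc (suc n)) β)
                     ≡ β 0 *ℤ Δ (suc n) +ᶻ (- + 1) *ℤ det (suc n) (withColumn (suc n) (λ k → β (suc k)))
  expand-first-row n β = begin
      cofactor fzero +ᶻ (cofactor (fsuc fzero) +ᶻ sumFin n (λ j → cofactor (fsuc (fsuc j))))
    ≡⟨ cong (λ z → cofactor fzero +ᶻ (cofactor (fsuc fzero) +ᶻ z)) (sumFin-zero n _ zero-entries) ⟩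
      cofactor fzero +ᶻ (cofactor (fsuc fzero) +ᶻ + 0)
    ≡⟨ cong₂ (λ x y → + 1 *ℤ (β 0 *ℤ x) +ᶻ ((- + 1) *ℤ (a 0 *ℤ y) +ᶻ + 0))
         (det-cong (suc n) (λ i k → M (fsuc i) (punchIn fzero k)) (H (suc n)) H-minor)
         (det-cong (suc n) (λ i k → M (fsuc i) (punchIn (fsuc fzero) k)) _ second-minor) ⟩
      + 1 *ℤ (β 0 *ℤ Δ (suc n)) +ᶻ ((- + 1) *ℤ (a 0 *ℤ Δ′) +ᶻ + 0)
    ≡⟨ cong (λ c → + 1 *ℤ (β 0 *ℤ Δ (suc n)) +ᶻ ((- + 1) *ℤ (c *ℤ Δ′) +ᶻ + 0)) a0≡1 ⟩
      + 1 *ℤ (β 0 *ℤ Δ (suc n)) +ᶻ ((- + 1) *ℤ (+ 1 *ℤ Δ′) +ᶻ + 0)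
    ≡⟨ tidy (β 0 *ℤ Δ (suc n)) Δ′ ⟩
      β 0 *ℤ Δ (suc n) +ᶻ (- + 1) *ℤ Δ′
    ∎
    where
    open ≡-Reasoning
    M : Fin (suc (suc n)) → Fin (suc (suc n)) → ℤ
    M = withColumn (suc (suc n)) β
    Δ′ : ℤ
    Δ′ = det (suc n) (withColumn (suc n) (λ k → β (suc k)))
    cofactor : Fin (suc (suc n)) → ℤ
    cofactor j = ((- + 1) ^ toℕ j) *ℤ (M fzero j *ℤ det (suc n) (λ i k → M (fsuc i) (punchIn j k)))
    zero-entries : ∀ j → cofactor (fsuc (fsuc j)) ≡ + 0
    zero-entries j = trans (cong (sign (toℕ (fsuc (fsuc j))) *ℤ_)
                               (ℤP.*-zeroˡ (det (suc n) (λ i k → M (fsuc i) (punchIn (fsuc (fsuc j)) k)))))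
                           (ℤP.*-zeroʳ (sign (toℕ (fsuc (fsuc j)))))
    second-minor : ∀ i k → M (fsuc i) (punchIn (fsuc fzero) k) ≡ withColumn (suc n) (λ k → β (suc k)) i k
    second-minor i fzero    = refl
    second-minor i (fsuc k) = H-minor i (fsuc k)
    tidy : ∀ x y → + 1 *ℤ x +ᶻ ((- + 1) *ℤ (+ 1 *ℤ y) +ᶻ + 0) ≡ x +ᶻ (- + 1) *ℤ y
    tidy = solve-∀

  expand-first-column : ∀ n β → det (suc n) (withColumn (suc n) β) ≡ Σ< (suc n) (λ i → sign i *ℤ (β i *ℤ Δ (n ∸ i)))
  expand-first-column zero    β = refl
  expand-first-column (suc n) β = begin
      det (suc (suc n)) (withColumn (suc (suc n)) β)
    ≡⟨ expand-first-row n β ⟩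
      β 0 *ℤ Δ (suc n) +ᶻ (- + 1) *ℤ det (suc n) (withColumn (suc n) (λ k → β (suc k)))
    ≡⟨ cong (λ z → β 0 *ℤ Δ (suc n) +ᶻ (- + 1) *ℤ z) (expand-first-column n (λ k → β (suc k))) ⟩
      β 0 *ℤ Δ (suc n) +ᶻ (- + 1) *ℤ Σ< (suc n) (λ i → sign i *ℤ (β (suc i) *ℤ Δ (n ∸ i)))
    ≡⟨ cong₂ _+ᶻ_ (sym (ℤP.*-identityˡ (β 0 *ℤ Δ (suc n)))) (sym (Σ<-* (suc n) (- + 1) (λ i → sign i *ℤ (β (suc i) *ℤ Δ (n ∸ i))))) ⟩
      sign 0 *ℤ (β 0 *ℤ Δ (suc n)) +ᶻ Σ< (suc n) (λ i → (- + 1) *ℤ (sign i *ℤ (β (suc i) *ℤ Δ (n ∸ i))))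
    ≡⟨ cong (sign 0 *ℤ (β 0 *ℤ Δ (suc n)) +ᶻ_) (Σ<-cong (suc n) (λ i _ → sym (ℤP.*-assoc (- + 1) (sign i) (β (suc i) *ℤ Δ (n ∸ i))))) ⟩
      Σ< (suc (suc n)) (λ i → sign i *ℤ (β i *ℤ Δ (suc n ∸ i)))
    ∎
    where open ≡-Reasoning

  Δ-recurrence : ∀ n → Δ (suc n) ≡ Σ< (suc n) (λ i → sign i *ℤ (a (suc i) *ℤ Δ (n ∸ i)))
  Δ-recurrence n = trans (det-cong (suc n) _ _ first-column) (expand-first-column n (λ k → a (suc k)))
    where
    first-column : ∀ i j → H (suc n) i j ≡ withColumn (suc n) (λ k → a (suc k)) i j
    first-column i fzero    = refl
    first-column i (fsuc j) = refl

  signedΔ : ℕ → ℤ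
  signedΔ n = sign n *ℤ Δ n

  signedΔ-inverse : ∀ n → (a ⊛ signedΔ) n ≡ δ n 0
  signedΔ-inverse zero    = cong (λ c → c *ℤ + 1 +ᶻ + 0) a0≡1
  signedΔ-inverse (suc n) = begin
      a 0 *ℤ signedΔ (suc n) +ᶻ Σ< (suc n) (λ k → a (suc k) *ℤ signedΔ (n ∸ k))
    ≡⟨ cong₂ (λ c z → c *ℤ signedΔ (suc n) +ᶻ z) a0≡1 (Σ<-cong (suc n) resign) ⟩
      + 1 *ℤ signedΔ (suc n) +ᶻ Σ< (suc n) (λ k → (- + 1) *ℤ (sign (suc n) *ℤ (sign k *ℤ (a (suc k) *ℤ Δ (n ∸ k)))))
    ≡⟨ cong (+ 1 *ℤ signedΔ (suc n) +ᶻ_) (trans (Σ<-* (suc n) (- + 1) (λ k → sign (suc n) *ℤ (sign k *ℤ (a (suc k) *ℤ Δ (n ∸ k)))))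
         (cong ((- + 1) *ℤ_) (trans (Σ<-* (suc n) (sign (suc n)) (λ k → sign k *ℤ (a (suc k) *ℤ Δ (n ∸ k)))) (cong (sign (suc n) *ℤ_) (sym (Δ-recurrence n)))))) ⟩
      + 1 *ℤ signedΔ (suc n) +ᶻ (- + 1) *ℤ signedΔ (suc n)
    ≡⟨ cancel (signedΔ (suc n)) ⟩
      + 0
    ∎
    where
    open ≡-Reasoning
    cancel : ∀ x → + 1 *ℤ x +ᶻ (- + 1) *ℤ x ≡ + 0
    cancel = solve-∀
    regroup : ∀ s t b d → (- + 1) *ℤ (((- + 1) *ℤ (s *ℤ t)) *ℤ (s *ℤ (b *ℤ d))) ≡ (s *ℤ s) *ℤ (b *ℤ (t *ℤ d))
    regroup = solve-∀
    -- the k-th term, with (-1)^(n-k) = (-1)^n (-1)^k pulled out of signedΔ (n - k)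
    resign : ∀ k → k < suc n → a (suc k) *ℤ signedΔ (n ∸ k)
                               ≡ (- + 1) *ℤ (sign (suc n) *ℤ (sign k *ℤ (a (suc k) *ℤ Δ (n ∸ k))))
    resign k (s≤s k≤n) = sym (begin
        (- + 1) *ℤ (((- + 1) *ℤ sign n) *ℤ (sign k *ℤ (a (suc k) *ℤ Δ (n ∸ k))))
      ≡⟨ cong (λ z → (- + 1) *ℤ (((- + 1) *ℤ z) *ℤ (sign k *ℤ (a (suc k) *ℤ Δ (n ∸ k))))) (sign-split k≤n) ⟩
        (- + 1) *ℤ (((- + 1) *ℤ (sign k *ℤ sign (n ∸ k))) *ℤ (sign k *ℤ (a (suc k) *ℤ Δ (n ∸ k))))
      ≡⟨ regroup (sign k) (sign (n ∸ k)) (a (suc k)) (Δ (n ∸ k)) ⟩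
        (sign k *ℤ sign k) *ℤ (a (suc k) *ℤ signedΔ (n ∸ k))
      ≡⟨ trans (cong (_*ℤ (a (suc k) *ℤ signedΔ (n ∸ k))) (sign-square k)) (ℤP.*-identityˡ _) ⟩
        a (suc k) *ℤ signedΔ (n ∸ k)
      ∎)

nth-hist : ∀ r n j → j < n → nth (hist r n) j ≡ T r (n ∸ suc j)
nth-hist r (suc n) zero    _         = refl
nth-hist r (suc n) (suc j) (s≤s j<n) = nth-hist r n j j<n

module Tribonacci (r : ℕ) (3≤r : 3 ≤ r) where

  suc-r∸1 : suc (r ∸ 1) ≡ r
  suc-r∸1 = shape r 3≤r
    where
    shape : ∀ r → 3 ≤ r → suc (r ∸ 1) ≡ r
    shape (suc r) _ = refl

  r∸2<r∸1 : r ∸ 2 < r ∸ 1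
  r∸2<r∸1 = shape r 3≤r
    where
    shape : ∀ r → 3 ≤ r → r ∸ 2 < r ∸ 1
    shape (suc (suc (suc r))) _ = ℕP.≤-refl
    shape (suc (suc zero)) (s≤s (s≤s ()))
    shape (suc zero)       (s≤s ())

  T-initial : ∀ {n} → n < r ∸ 1 → T r n ≡ 0
  T-initial {n} n<r-1 with n <ᵇ r ∸ 1 in lt
  ... | true  = refl
  ... | false = ⊥-elim (subst Bool.T lt (ℕP.<⇒<ᵇ n<r-1))

  T-r∸1 : T r (r ∸ 1) ≡ 1
  T-r∸1 with (r ∸ 1) <ᵇ (r ∸ 1) in lt | (r ∸ 1) ≡ᵇ (r ∸ 1) in eq
  ... | true  | _     = ⊥-elim (ℕP.<-irrefl refl (ℕP.<ᵇ⇒< (r ∸ 1) (r ∸ 1) (subst Bool.T (sym lt) tt)))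
  ... | false | true  = refl
  ... | false | false = ⊥-elim (subst Bool.T eq (ℕP.≡⇒≡ᵇ (r ∸ 1) (r ∸ 1) refl))

  T-rec : ∀ {n} → r ≤ n → T r n ≡ T r (n ∸ 1) + T r (n ∸ 2) + T r (n ∸ r)
  T-rec {n} r≤n with n <ᵇ r ∸ 1 in lt | n ≡ᵇ r ∸ 1 in eq
  ... | true  | _     = ⊥-elim (ℕP.<-asym r-1<n (ℕP.<ᵇ⇒< n (r ∸ 1) (subst Bool.T (sym lt) tt)))
    where r-1<n = subst (_≤ n) (sym suc-r∸1) r≤n
  ... | false | true  = ⊥-elim (ℕP.<-irrefl (sym (ℕP.≡ᵇ⇒≡ n (r ∸ 1) (subst Bool.T (sym eq) tt)))
                                           (subst (_≤ n) (sym suc-r∸1) r≤n))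
  ... | false | false =
    cong₂ _+_ (cong₂ _+_ (nth-hist r n 0 0<n) (nth-hist r n 1 1<n))
              (trans (nth-hist r n (r ∸ 1) (subst (_≤ n) (sym suc-r∸1) r≤n)) (cong (λ x → T r (n ∸ x)) suc-r∸1))
    where
    1<n : 1 < n
    1<n = ℕP.≤-trans (s≤s (s≤s z≤n)) (ℕP.≤-trans 3≤r r≤n)
    0<n : 0 < n
    0<n = ℕP.<-trans (s≤s z≤n) 1<n

  T-r : T r r ≡ 1
  T-r = trans (T-rec ℕP.≤-refl)
              (cong₂ _+_ (cong₂ _+_ T-r∸1 (T-initial r∸2<r∸1))
                         (trans (cong (T r) (ℕP.n∸n≡0 r)) (T-initial (ℕP.≤-<-trans z≤n r∸2<r∸1))))

  τ : ℕ → ℤ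
  τ n = + T r n

  τ-rec : ∀ {M} → r ≤ M → τ M ≡ τ (M ∸ 1) +ᶻ τ (M ∸ 2) +ᶻ τ (M ∸ r)
  τ-rec {M} r≤M = trans (cong +_ (T-rec r≤M))
    (trans (ℤP.pos-+ (T r (M ∸ 1) + T r (M ∸ 2)) (T r (M ∸ r)))
           (cong (_+ᶻ τ (M ∸ r)) (ℤP.pos-+ (T r (M ∸ 1)) (T r (M ∸ 2)))))

  τ-before : ∀ i M → M < r ∸ 1 + i → shift i τ M ≡ + 0
  τ-before i M M<r-1+i = by-cases (i ≤? M)
    where
    by-cases : Dec (i ≤ M) → shift i τ M ≡ + 0
    by-cases (yes i≤M) = trans (shift-≤ τ i≤M)
      (cong +_ (T-initial (subst (M ∸ i <_) (ℕP.m+n∸n≡m (r ∸ 1) i) (ℕP.∸-monoˡ-< M<r-1+i i≤M))))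
    by-cases (no i≰M)  = shift-≰ τ i≰M

  characteristic : ∀ M → τ M +ᶻ - shift 1 τ M +ᶻ - shift 2 τ M +ᶻ - shift r τ M ≡ δ M (r ∸ 1)
  characteristic M with ℕP.<-cmp M (r ∸ 1)
  ... | tri< M<r-1 _ _ rewrite T-initial M<r-1
        | τ-before 1 M (ℕP.<-≤-trans M<r-1 (ℕP.m≤m+n (r ∸ 1) 1))
        | τ-before 2 M (ℕP.<-≤-trans M<r-1 (ℕP.m≤m+n (r ∸ 1) 2))
        | τ-before r M (ℕP.<-≤-trans M<r-1 (ℕP.m≤m+n (r ∸ 1) r))
        | δ-no (ℕP.<⇒≢ M<r-1) = refl
  ... | tri≈ _ refl _ rewrite T-r∸1
        | τ-before 1 (r ∸ 1) (ℕP.m<m+n (r ∸ 1) {1} (s≤s z≤n))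
        | τ-before 2 (r ∸ 1) (ℕP.m<m+n (r ∸ 1) {2} (s≤s z≤n))
        | τ-before r (r ∸ 1) (ℕP.m<m+n (r ∸ 1) {r} (ℕP.≤-trans (s≤s z≤n) 3≤r))
        | δ-yes {r ∸ 1} refl = refl
  ... | tri> _ _ r-1<M = begin
      τ M +ᶻ - shift 1 τ M +ᶻ - shift 2 τ M +ᶻ - shift r τ M
    ≡⟨ cong₂ (λ x y → τ M +ᶻ - x +ᶻ - y +ᶻ - shift r τ M)
             (shift-≤ τ (ℕP.≤-trans (s≤s z≤n) i≤M)) (shift-≤ τ (ℕP.≤-trans (s≤s (s≤s z≤n)) i≤M)) ⟩
      τ M +ᶻ - τ (M ∸ 1) +ᶻ - τ (M ∸ 2) +ᶻ - shift r τ M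
    ≡⟨ cong₂ (λ x y → x +ᶻ - τ (M ∸ 1) +ᶻ - τ (M ∸ 2) +ᶻ - y) (τ-rec r≤M) (shift-≤ τ r≤M) ⟩
      τ (M ∸ 1) +ᶻ τ (M ∸ 2) +ᶻ τ (M ∸ r) +ᶻ - τ (M ∸ 1) +ᶻ - τ (M ∸ 2) +ᶻ - τ (M ∸ r)
    ≡⟨ cancel (τ (M ∸ 1)) (τ (M ∸ 2)) (τ (M ∸ r)) ⟩
      + 0
    ≡⟨ sym (δ-no (ℕP.>⇒≢ r-1<M)) ⟩
      δ M (r ∸ 1)
    ∎
    where
    open ≡-Reasoning
    r≤M : r ≤ M
    r≤M = subst (_≤ M) suc-r∸1 r-1<M
    i≤M : 2 ≤ M
    i≤M = ℕP.≤-trans (ℕP.≤-trans (s≤s (s≤s z≤n)) 3≤r) r≤M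
    cancel : ∀ x y z → x +ᶻ y +ᶻ z +ᶻ - x +ᶻ - y +ᶻ - z ≡ + 0
    cancel = solve-∀

  shiftedCharacteristic : ℕ → ℕ → ℤ
  shiftedCharacteristic j N =
    shift j τ N +ᶻ - shift (j + 1) τ N +ᶻ - shift (j + 2) τ N +ᶻ - shift (j + r) τ N

  characteristic-offset : ∀ j M → shiftedCharacteristic j (j + M) ≡ δ (j + M) (j + (r ∸ 1))
  characteristic-offset j M = begin
      shiftedCharacteristic j (j + M)
    ≡⟨ cong-terms (trans (cong (λ k → shift k τ (j + M)) (sym (ℕP.+-identityʳ j))) (trans (shift-+ τ j 0 M) (shift-≤ τ z≤n)))
                  (shift-+ τ j 1 M) (shift-+ τ j 2 M) (shift-+ τ j r M) ⟩
      τ M +ᶻ - shift 1 τ M +ᶻ - shift 2 τ M +ᶻ - shift r τ M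
    ≡⟨ characteristic M ⟩
      δ M (r ∸ 1)
    ≡⟨ sym (δ-+ j M (r ∸ 1)) ⟩
      δ (j + M) (j + (r ∸ 1))
    ∎
    where
    open ≡-Reasoning
    cong-terms : ∀ {a₀ b₀ a₁ b₁ a₂ b₂ a₃ b₃} → a₀ ≡ b₀ → a₁ ≡ b₁ → a₂ ≡ b₂ → a₃ ≡ b₃ →
                 a₀ +ᶻ - a₁ +ᶻ - a₂ +ᶻ - a₃ ≡ b₀ +ᶻ - b₁ +ᶻ - b₂ +ᶻ - b₃
    cong-terms refl refl refl refl = refl

  characteristic-shifted : ∀ j N → shiftedCharacteristic j N ≡ δ N (j + (r ∸ 1))
  characteristic-shifted j N = by-cases (j ≤? N)
    where
    by-cases : Dec (j ≤ N) → shiftedCharacteristic j N ≡ δ N (j + (r ∸ 1))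
    by-cases (yes j≤N) = subst (λ N → shiftedCharacteristic j N ≡ δ N (j + (r ∸ 1)))
                               (ℕP.m+[n∸m]≡n j≤N) (characteristic-offset j (N ∸ j))
    by-cases (no j≰N) rewrite shift-≰ τ j≰N
                            | shift-≰ τ (λ le → j≰N (ℕP.≤-trans (ℕP.m≤m+n j 1) le))
                            | shift-≰ τ (λ le → j≰N (ℕP.≤-trans (ℕP.m≤m+n j 2) le))
                            | shift-≰ τ (λ le → j≰N (ℕP.≤-trans (ℕP.m≤m+n j r) le))
                            | δ-no {N} {j + (r ∸ 1)} (λ eq → j≰N (ℕP.≤-trans (ℕP.m≤m+n j (r ∸ 1)) (ℕP.≤-reflexive (sym eq))))
                            = refl

  -- Multiplying by 1 + x - x² + x^r leaves only even powers of x on the left: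
  -- (1 - 3x² + x⁴ - 2x^(r+1) - x^(2r)) · τ(x) = x^(r-1) (1 + x - x² + x^r).
  even-identity : ∀ N →
    shift 0 τ N +ᶻ (- + 3) *ℤ shift 2 τ N +ᶻ shift 4 τ N +ᶻ (- + 2) *ℤ shift (suc r) τ N +ᶻ - shift (r + r) τ N
    ≡ δ N (r ∸ 1) +ᶻ δ N (1 + (r ∸ 1)) +ᶻ - δ N (2 + (r ∸ 1)) +ᶻ δ N (r + (r ∸ 1))
  even-identity N = trans (combine (s 0) (s 1) (s 2) (s 3) (s 4) (s r) (s (suc r)) (s (suc (suc r))) (s (r + r)))
    (cong₂ _+ᶻ_ (cong₂ _+ᶻ_ (cong₂ _+ᶻ_ (characteristic-shifted 0 N) (characteristic-shifted 1 N))
                            (cong -_ (characteristic-shifted 2 N)))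
                (trans (cong₂ (λ x y → shift r τ N +ᶻ - shift x τ N +ᶻ - shift y τ N +ᶻ - shift (r + r) τ N)
                              (ℕP.+-comm 1 r) (ℕP.+-comm 2 r))
                       (characteristic-shifted r N)))
    where
    s : ℕ → ℤ
    s i = shift i τ N
    combine : ∀ a₀ a₁ a₂ a₃ a₄ aᵣ aᵣ₁ aᵣ₂ aᵣᵣ →
      a₀ +ᶻ (- + 3) *ℤ a₂ +ᶻ a₄ +ᶻ (- + 2) *ℤ aᵣ₁ +ᶻ - aᵣᵣ ≡
      (a₀ +ᶻ - a₁ +ᶻ - a₂ +ᶻ - aᵣ) +ᶻ (a₁ +ᶻ - a₂ +ᶻ - a₃ +ᶻ - aᵣ₁)
        +ᶻ - (a₂ +ᶻ - a₃ +ᶻ - a₄ +ᶻ - aᵣ₂) +ᶻ (aᵣ +ᶻ - aᵣ₁ +ᶻ - aᵣ₂ +ᶻ - aᵣᵣ)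
    combine = solve-∀

module OddOrder (m : ℕ) (1≤m : 1 ≤ m) where

  r : ℕ
  r = suc (2 * m)

  3≤r : 3 ≤ r
  3≤r = s≤s (ℕP.*-monoʳ-≤ 2 1≤m)

  open Tribonacci r 3≤r public

  a : ℕ → ℤ
  a = seqA r

  open ToeplitzHessenberg a refl public

  -- The entries are the even-offset tribonacci numbers a k = T (r + 2k), also for k = 0 as T r = 1.
  a≡τ : ∀ k → a k ≡ τ (r + 2 * k)
  a≡τ zero    = cong +_ (sym (trans (cong (T r) (ℕP.+-identityʳ r)) T-r))
  a≡τ (suc k) = refl

  shift-a : ∀ n j → shift j a n ≡ shift (2 * j) τ (r + 2 * n)
  shift-a n j = by-cases (j ≤? n)
    where
    by-cases : Dec (j ≤ n) → shift j a n ≡ shift (2 * j) τ (r + 2 * n)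
    by-cases (yes j≤n) = begin
        shift j a n                ≡⟨ shift-≤ a j≤n ⟩
        a (n ∸ j)                  ≡⟨ a≡τ (n ∸ j) ⟩
        τ (r + 2 * (n ∸ j))        ≡⟨ cong (λ k → τ (r + k)) (ℕP.*-distribˡ-∸ 2 n j) ⟩
        τ (r + (2 * n ∸ 2 * j))    ≡⟨ cong τ (sym (ℕP.+-∸-assoc r 2j≤2n)) ⟩
        τ (r + 2 * n ∸ 2 * j)      ≡⟨ sym (shift-≤ τ (ℕP.≤-trans 2j≤2n (ℕP.m≤n+m (2 * n) r))) ⟩
        shift (2 * j) τ (r + 2 * n) ∎
      where
      open ≡-Reasoning
      2j≤2n : 2 * j ≤ 2 * n
      2j≤2n = ℕP.*-monoʳ-≤ 2 j≤n
    by-cases (no j≰n) = trans (shift-≰ a j≰n) (sym (τ-before (2 * j) (r + 2 * n) early))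
      where
      early : r + 2 * n < r ∸ 1 + 2 * j
      early = subst (_≤ r ∸ 1 + 2 * j) (rearrange m n) (ℕP.+-monoʳ-≤ (2 * m) (ℕP.*-monoʳ-≤ 2 (ℕP.≰⇒> j≰n)))
        where
        rearrange : ∀ m n → 2 * m + 2 * suc n ≡ suc (suc (2 * m + 2 * n))
        rearrange = ℕSolver.solve-∀

  numerator : List (ℤ × ℕ)
  numerator = (+ 1 , 0) ∷ (- + 3 , 1) ∷ (+ 1 , 2) ∷ (- + 2 , suc m) ∷ (- + 1 , r) ∷ []

  P : ℕ → ℤ
  P = poly numerator

  P-beyond : ∀ i → r < i → P i ≡ + 0
  P-beyond i r<i rewrite δ-< {i} 0 (ℕP.≤-<-trans z≤n r<i)
                       | δ-< {i} 1 (ℕP.≤-<-trans (s≤s z≤n) r<i)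
                       | δ-< {i} 2 (ℕP.≤-<-trans (s≤s (ℕP.≤-trans 1≤m (ℕP.m≤m+n m (m + 0)))) r<i)
                       | δ-< {i} (suc m) (ℕP.≤-<-trans (s≤s (ℕP.m≤m+n m (m + 0))) r<i)
                       | δ-< {i} r r<i = refl

  -- In the numerator applied to a, every shift x^j a(x) is a shift x^(2j) τ(x) at N = r + 2n,
  -- and the combination is the left-hand side of the even identity.
  numerator-via-τ : ∀ n → let N = r + 2 * n in
    act numerator a n
    ≡ shift 0 τ N +ᶻ (- + 3) *ℤ shift 2 τ N +ᶻ shift 4 τ N +ᶻ (- + 2) *ℤ shift (suc r) τ N +ᶻ - shift (r + r) τ N
  numerator-via-τ n =
    combine (shift-a n 0) (shift-a n 1) (shift-a n 2)
            (trans (shift-a n (suc m)) (cong (λ k → shift k τ N) (ℕP.*-suc 2 m)))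
            (trans (shift-a n r) (cong (λ k → shift (r + k) τ N) (ℕP.+-identityʳ r)))
    where
    N : ℕ
    N = r + 2 * n
    combine : ∀ {x₀ x₁ x₂ x₃ x₄ y₀ y₁ y₂ y₃ y₄} → x₀ ≡ y₀ → x₁ ≡ y₁ → x₂ ≡ y₂ → x₃ ≡ y₃ → x₄ ≡ y₄ →
      + 1 *ℤ x₀ +ᶻ ((- + 3) *ℤ x₁ +ᶻ (+ 1 *ℤ x₂ +ᶻ ((- + 2) *ℤ x₃ +ᶻ ((- + 1) *ℤ x₄ +ᶻ + 0))))
      ≡ y₀ +ᶻ (- + 3) *ℤ y₁ +ᶻ y₂ +ᶻ (- + 2) *ℤ y₃ +ᶻ - y₄
    combine {y₀ = y₀} {y₁} {y₂} {y₃} {y₄} refl refl refl refl refl = reorder y₀ y₁ y₂ y₃ y₄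
      where
      reorder : ∀ y₀ y₁ y₂ y₃ y₄ →
        + 1 *ℤ y₀ +ᶻ ((- + 3) *ℤ y₁ +ᶻ (+ 1 *ℤ y₂ +ᶻ ((- + 2) *ℤ y₃ +ᶻ ((- + 1) *ℤ y₄ +ᶻ + 0))))
        ≡ y₀ +ᶻ (- + 3) *ℤ y₁ +ᶻ y₂ +ᶻ (- + 2) *ℤ y₃ +ᶻ - y₄
      reorder = solve-∀

  -- At N = r + 2n only x^r and x^(2r-1) on the right of the even identity contribute,
  -- giving the coefficients of 1 + x^m at n.
  even-identity-rhs : ∀ n → let N = r + 2 * n in
    δ N (2 * m) +ᶻ δ N (suc (2 * m)) +ᶻ - δ N (2 + 2 * m) +ᶻ δ N (r + 2 * m) ≡ δ n 0 +ᶻ δ n m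
  even-identity-rhs n = trans (cong₂ _+ᶻ_ (cong₂ _+ᶻ_ (cong₂ _+ᶻ_ too-small constant) (cong -_ odd)) top)
                              (tidy (δ n 0) (δ n m))
    where
    N : ℕ
    N = r + 2 * n
    too-small : δ N (2 * m) ≡ + 0
    too-small = δ-< (2 * m) (s≤s (ℕP.m≤m+n (2 * m) (2 * n)))
    constant : δ N (suc (2 * m)) ≡ δ n 0
    constant = trans (cong (δ N) (sym (ℕP.+-identityʳ r))) (trans (δ-+ r (2 * n) 0) (δ-double n 0))
    odd : δ N (2 + 2 * m) ≡ + 0
    odd = trans (cong (δ N) (ℕP.+-comm 1 r)) (trans (δ-+ r (2 * n) 1) (δ-even-1 n))
    top : δ N (r + 2 * m) ≡ δ n m
    top = trans (δ-+ r (2 * n) (2 * m)) (δ-double n m)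
    tidy : ∀ x y → + 0 +ᶻ x +ᶻ - + 0 +ᶻ y ≡ x +ᶻ y
    tidy = solve-∀

  a⊛P : ∀ n → (a ⊛ P) n ≡ δ n 0 +ᶻ δ n m
  a⊛P n = begin
    (a ⊛ P) n               ≡⟨ ⊛-poly a numerator n ⟩
    act numerator a n       ≡⟨ numerator-via-τ n ⟩
    _                       ≡⟨ even-identity (r + 2 * n) ⟩
    _                       ≡⟨ even-identity-rhs n ⟩
    δ n 0 +ᶻ δ n m          ∎
    where open ≡-Reasoning

  signedΔ-quotient : ∀ n → signedΔ n +ᶻ shift m signedΔ n ≡ P n
  signedΔ-quotient n = trans (isolate (signedΔ n +ᶻ shift m signedΔ n) (P n))
                             (trans (cong (_+ᶻ P n) (⊛-cancel a defect refl a⊛defect n)) (ℤP.+-identityˡ (P n)))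
    where
    defect : ℕ → ℤ
    defect i = signedΔ i +ᶻ shift m signedΔ i +ᶻ (- + 1) *ℤ P i
    a⊛defect : ∀ n → (a ⊛ defect) n ≡ + 0
    a⊛defect n = begin
        (a ⊛ defect) n
      ≡⟨ trans (⊛-+ a (λ i → signedΔ i +ᶻ shift m signedΔ i) (λ i → (- + 1) *ℤ P i) n)
               (cong₂ _+ᶻ_ (⊛-+ a signedΔ (shift m signedΔ) n) (⊛-scale a (- + 1) P n)) ⟩
        (a ⊛ signedΔ) n +ᶻ (a ⊛ shift m signedΔ) n +ᶻ (- + 1) *ℤ (a ⊛ P) n
      ≡⟨ cong₂ (λ x y → (a ⊛ signedΔ) n +ᶻ x +ᶻ (- + 1) *ℤ y)
               (trans (⊛-shift a m signedΔ n) (shift-cong m signedΔ-inverse n)) (a⊛P n) ⟩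
        (a ⊛ signedΔ) n +ᶻ shift m (λ i → δ i 0) n +ᶻ (- + 1) *ℤ (δ n 0 +ᶻ δ n m)
      ≡⟨ cong₂ (λ x y → x +ᶻ y +ᶻ (- + 1) *ℤ (δ n 0 +ᶻ δ n m)) (signedΔ-inverse n) (shift-δ m n) ⟩
        δ n 0 +ᶻ δ n m +ᶻ (- + 1) *ℤ (δ n 0 +ᶻ δ n m)
      ≡⟨ cancel (δ n 0 +ᶻ δ n m) ⟩
        + 0
      ∎
      where
      open ≡-Reasoning
      cancel : ∀ x → x +ᶻ (- + 1) *ℤ x ≡ + 0
      cancel = solve-∀
    isolate : ∀ x p → x ≡ (x +ᶻ (- + 1) *ℤ p) +ᶻ p
    isolate = solve-∀

  signedΔ-step : ∀ x → signedΔ (m + x) ≡ P (m + x) +ᶻ - signedΔ x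
  signedΔ-step x = begin
      signedΔ (m + x)                                       ≡⟨ solve-for (signedΔ (m + x)) (signedΔ x) ⟩
      (signedΔ (m + x) +ᶻ signedΔ x) +ᶻ - signedΔ x         ≡⟨ cong (λ z → (signedΔ (m + x) +ᶻ z) +ᶻ - signedΔ x) (sym earlier) ⟩
      (signedΔ (m + x) +ᶻ shift m signedΔ (m + x)) +ᶻ - signedΔ x ≡⟨ cong (_+ᶻ - signedΔ x) (signedΔ-quotient (m + x)) ⟩
      P (m + x) +ᶻ - signedΔ x                              ∎
    where
    open ≡-Reasoning
    earlier : shift m signedΔ (m + x) ≡ signedΔ x
    earlier = trans (shift-≤ signedΔ (ℕP.m≤m+n m x)) (cong signedΔ (ℕP.m+n∸m≡n m x))
    solve-for : ∀ y z → y ≡ (y +ᶻ z) +ᶻ - z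
    solve-for = solve-∀

  -- Below degree m the shifted term is absent, so signedΔ agrees with P.
  signedΔ-initial : ∀ j → j < m → signedΔ j ≡ P j
  signedΔ-initial j j<m =
    trans (sym (ℤP.+-identityʳ (signedΔ j)))
          (trans (cong (signedΔ j +ᶻ_) (sym (shift-≰ signedΔ (ℕP.<⇒≱ j<m)))) (signedΔ-quotient j))

  D≡signedΔ : ∀ n → D r n ≡ sign n *ℤ signedΔ n
  D≡signedΔ n = sym (trans (sym (ℤP.*-assoc (sign n) (sign n) (Δ n)))
                           (trans (cong (_*ℤ Δ n) (sign-square n)) (ℤP.*-identityˡ (Δ n))))

module LargeOrder (m : ℕ) (3≤m : 3 ≤ m) where

  1≤m : 1 ≤ m
  1≤m = ℕP.≤-trans (s≤s z≤n) 3≤m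

  open OddOrder m 1≤m

  3≤m+ : ∀ x → 3 ≤ m + x
  3≤m+ x = ℕP.≤-trans 3≤m (ℕP.m≤m+n m x)

  r≡m+suc-m : r ≡ m + suc m
  r≡m+suc-m = trans (cong (λ k → suc (m + k)) (ℕP.+-identityʳ m)) (sym (ℕP.+-suc m m))

  P-initial : ∀ j → j < m → P j ≡ δ j 0 +ᶻ (- + 3) *ℤ δ j 1 +ᶻ δ j 2
  P-initial j j<m rewrite δ-no {j} {suc m} (λ eq → ℕP.<-irrefl eq (ℕP.m≤n⇒m≤1+n j<m))
                        | δ-no {j} {r} (λ eq → ℕP.<-irrefl eq (ℕP.≤-trans j<m (ℕP.≤-trans (ℕP.n≤1+n m) (s≤s (ℕP.m≤m+n m (m + 0))))))
    = tidy (δ j 0) (δ j 1) (δ j 2)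
    where
    tidy : ∀ x y z → + 1 *ℤ x +ᶻ ((- + 3) *ℤ y +ᶻ (+ 1 *ℤ z +ᶻ ((- + 2) *ℤ + 0 +ᶻ ((- + 1) *ℤ + 0 +ᶻ + 0))))
                     ≡ x +ᶻ (- + 3) *ℤ y +ᶻ z
    tidy = solve-∀

  P-later : ∀ x → P (m + x) ≡ (- + 2) *ℤ δ x 1 +ᶻ - δ x (suc m)
  P-later x rewrite δ-< {m + x} 0 (ℕP.≤-trans (s≤s z≤n) (3≤m+ x))
                  | δ-< {m + x} 1 (ℕP.≤-trans (s≤s (s≤s z≤n)) (3≤m+ x))
                  | δ-< {m + x} 2 (3≤m+ x)
                  | trans (cong (δ (m + x)) (ℕP.+-comm 1 m)) (δ-+ m x 1)
                  | trans (cong (δ (m + x)) r≡m+suc-m) (δ-+ m x (suc m))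
    = tidy (δ x 1) (δ x (suc m))
    where
    tidy : ∀ y z → + 1 *ℤ + 0 +ᶻ ((- + 3) *ℤ + 0 +ᶻ (+ 1 *ℤ + 0 +ᶻ ((- + 2) *ℤ y +ᶻ ((- + 1) *ℤ z +ᶻ + 0))))
                   ≡ (- + 2) *ℤ y +ᶻ - z
    tidy = solve-∀

  blockValue : ℕ → ℕ → ℤ
  blockValue zero          j = δ j 0 +ᶻ (- + 3) *ℤ δ j 1 +ᶻ δ j 2
  blockValue (suc zero)    j = - (δ j 0 +ᶻ - δ j 1 +ᶻ δ j 2)
  blockValue (suc (suc p)) j = sign (suc (suc p)) *ℤ (δ j 0 +ᶻ (- + 2) *ℤ δ j 1 +ᶻ δ j 2)

  beyond-m+1 : ∀ p j → suc m < suc (suc p) * m + j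
  beyond-m+1 p j =
    ℕP.≤-trans (subst (_≤ m + m) (ℕP.+-comm m 2) (ℕP.+-monoʳ-≤ m (ℕP.≤-trans (s≤s (s≤s z≤n)) 3≤m)))
      (ℕP.≤-trans (ℕP.+-monoʳ-≤ m (ℕP.m≤m+n m (p * m))) (ℕP.m≤m+n (suc (suc p) * m) j))

  next-block : ∀ q j → j < m →
    (- + 2) *ℤ δ (q * m + j) 1 +ᶻ - δ (q * m + j) (suc m) +ᶻ - blockValue q j ≡ blockValue (suc q) j
  next-block zero j j<m rewrite δ-no {j} {suc m} (λ eq → ℕP.<-irrefl eq (ℕP.m≤n⇒m≤1+n j<m)) =
    shape (δ j 0) (δ j 1) (δ j 2)
    where
    shape : ∀ x y z → (- + 2) *ℤ y +ᶻ - + 0 +ᶻ - (x +ᶻ (- + 3) *ℤ y +ᶻ z) ≡ - (x +ᶻ - y +ᶻ z)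
    shape = solve-∀
  next-block (suc zero) j j<m
    rewrite ℕP.+-identityʳ m
          | δ-< {m + j} 1 (ℕP.≤-trans (s≤s (s≤s z≤n)) (3≤m+ j))
          | trans (cong (δ (m + j)) (ℕP.+-comm 1 m)) (δ-+ m j 1) =
    shape (δ j 0) (δ j 1) (δ j 2)
    where
    shape : ∀ x y z → (- + 2) *ℤ + 0 +ᶻ - y +ᶻ - - (x +ᶻ - y +ᶻ z) ≡ (- + 1) *ℤ ((- + 1) *ℤ + 1) *ℤ (x +ᶻ (- + 2) *ℤ y +ᶻ z)
    shape = solve-∀
  next-block (suc (suc p)) j j<m
    rewrite δ-< {suc (suc p) * m + j} 1 (ℕP.<-trans (s≤s 1≤m) (beyond-m+1 p j))
          | δ-< {suc (suc p) * m + j} (suc m) (beyond-m+1 p j) =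
    shape (sign p) (δ j 0 +ᶻ (- + 2) *ℤ δ j 1 +ᶻ δ j 2)
    where
    shape : ∀ s c → (- + 2) *ℤ + 0 +ᶻ - + 0 +ᶻ - ((- + 1) *ℤ ((- + 1) *ℤ s) *ℤ c)
                    ≡ (- + 1) *ℤ ((- + 1) *ℤ ((- + 1) *ℤ s)) *ℤ c
    shape = solve-∀

  signedΔ-block : ∀ q j → j < m → signedΔ (q * m + j) ≡ blockValue q j
  signedΔ-block zero    j j<m = trans (signedΔ-initial j j<m) (P-initial j j<m)
  signedΔ-block (suc q) j j<m = begin
      signedΔ (suc q * m + j)                                        ≡⟨ cong signedΔ (ℕP.+-assoc m (q * m) j) ⟩
      signedΔ (m + (q * m + j))                                      ≡⟨ signedΔ-step (q * m + j) ⟩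
      P (m + (q * m + j)) +ᶻ - signedΔ (q * m + j)                   ≡⟨ cong₂ (λ x y → x +ᶻ - y) (P-later (q * m + j)) (signedΔ-block q j j<m) ⟩
      (- + 2) *ℤ δ (q * m + j) 1 +ᶻ - δ (q * m + j) (suc m) +ᶻ - blockValue q j ≡⟨ next-block q j j<m ⟩
      blockValue (suc q) j                                           ∎
    where open ≡-Reasoning

  blockValue-0 : ∀ p → blockValue (suc (suc p)) 0 ≡ sign (suc (suc p))
  blockValue-0 p = shape (sign (suc (suc p)))
    where
    shape : ∀ s → s *ℤ (+ 1 +ᶻ (- + 2) *ℤ + 0 +ᶻ + 0) ≡ s
    shape = solve-∀

  blockValue-1 : ∀ p → blockValue (suc (suc p)) 1 ≡ (- + 2) *ℤ sign (suc (suc p))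
  blockValue-1 p = shape (sign (suc (suc p)))
    where
    shape : ∀ s → s *ℤ (+ 0 +ᶻ (- + 2) *ℤ + 1 +ᶻ + 0) ≡ (- + 2) *ℤ s
    shape = solve-∀

  blockValue-2 : ∀ q → 1 ≤ q → blockValue q 2 ≡ sign q
  blockValue-2 (suc zero)    _ = refl
  blockValue-2 (suc (suc p)) _ = shape (sign (suc (suc p)))
    where
    shape : ∀ s → s *ℤ (+ 0 +ᶻ (- + 2) *ℤ + 0 +ᶻ + 1) ≡ s
    shape = solve-∀

  blockValue-beyond : ∀ q j → 3 ≤ j → blockValue q j ≡ + 0
  blockValue-beyond q j 3≤j =
    vanish q (δ-< 0 (ℕP.≤-trans (s≤s z≤n) 3≤j)) (δ-< 1 (ℕP.≤-trans (s≤s (s≤s z≤n)) 3≤j)) (δ-< 2 3≤j)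
    where
    vanish : ∀ q → δ j 0 ≡ + 0 → δ j 1 ≡ + 0 → δ j 2 ≡ + 0 → blockValue q j ≡ + 0
    vanish zero          e₀ e₁ e₂ rewrite e₀ | e₁ | e₂ = refl
    vanish (suc zero)    e₀ e₁ e₂ rewrite e₀ | e₁ | e₂ = refl
    vanish (suc (suc p)) e₀ e₁ e₂ rewrite e₀ | e₁ | e₂ = ℤP.*-zeroʳ (sign (suc (suc p)))

  D-block : ∀ {n} q j → n ≡ q * m + j → j < m → D r n ≡ sign n *ℤ blockValue q j
  D-block {n} q j refl j<m = trans (D≡signedΔ n) (cong (sign n *ℤ_) (signedΔ-block q j j<m))

  q≤q*m : ∀ q → q ≤ q * m
  q≤q*m q = ℕP.≤-trans (ℕP.≤-reflexive (sym (ℕP.*-identityʳ q))) (ℕP.*-monoʳ-≤ q 1≤m)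

  not-first-block : ¬ suc (suc m) ≤ m + 0
  not-first-block le = ℕP.<-irrefl (sym (ℕP.+-identityʳ m)) (ℕP.≤-trans (ℕP.n≤1+n (suc m)) le)

  multiple : ∀ q n → n ≡ q * m → suc (suc m) ≤ n → D r n ≡ sign (n ∸ q)
  multiple zero          .0       refl ()
  multiple (suc zero)    .(m + 0) refl m+2≤n = ⊥-elim (not-first-block m+2≤n)
  multiple q@(suc (suc p)) n n≡qm _ = begin
      D r n                       ≡⟨ D-block q 0 (trans n≡qm (sym (ℕP.+-identityʳ (q * m)))) (ℕP.≤-trans (s≤s z≤n) 1≤m) ⟩
      sign n *ℤ blockValue q 0    ≡⟨ cong (sign n *ℤ_) (blockValue-0 p) ⟩
      sign n *ℤ sign q            ≡⟨ sym (sign-∸ (subst (q ≤_) (sym n≡qm) (q≤q*m q))) ⟩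
      sign (n ∸ q)                ∎
    where open ≡-Reasoning

  multiple+1 : ∀ q n → n ∸ 1 ≡ q * m → suc (suc m) ≤ n → D r n ≡ + 2 *ℤ sign (n ∸ 1 ∸ q)
  multiple+1 zero          (suc .0)       refl (s≤s ())
  multiple+1 (suc zero)    (suc .(m + 0)) refl (s≤s m+1≤m) = ⊥-elim (ℕP.<-irrefl (sym (ℕP.+-identityʳ m)) m+1≤m)
  multiple+1 q@(suc (suc p)) (suc n′) n′≡qm _ = begin
      D r (suc n′)                              ≡⟨ D-block q 1 (trans (cong suc n′≡qm) (ℕP.+-comm 1 (q * m))) (ℕP.≤-trans (s≤s (s≤s z≤n)) 3≤m) ⟩
      sign (suc n′) *ℤ blockValue q 1           ≡⟨ cong (sign (suc n′) *ℤ_) (blockValue-1 p) ⟩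
      ((- + 1) *ℤ sign n′) *ℤ ((- + 2) *ℤ sign q) ≡⟨ shape (sign n′) (sign q) ⟩
      + 2 *ℤ (sign n′ *ℤ sign q)                ≡⟨ cong (+ 2 *ℤ_) (sym (sign-∸ (subst (q ≤_) (sym n′≡qm) (q≤q*m q)))) ⟩
      + 2 *ℤ sign (n′ ∸ q)                      ∎
    where
    open ≡-Reasoning
    shape : ∀ s t → ((- + 1) *ℤ s) *ℤ ((- + 2) *ℤ t) ≡ + 2 *ℤ (s *ℤ t)
    shape = solve-∀

  multiple+2 : ∀ q n → n ∸ 2 ≡ q * m → suc (suc m) ≤ n → D r n ≡ sign (n ∸ q)
  multiple+2 zero (suc (suc .0)) refl (s≤s (s≤s m≤0)) = ⊥-elim (ℕP.<⇒≱ (ℕP.≤-trans (s≤s z≤n) 3≤m) m≤0)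
  multiple+2 (suc q) (suc zero) _ (s≤s ())
  multiple+2 (suc q) (suc (suc n″)) n″≡qm _ = begin
      D r n                          ≡⟨ D-block (suc q) 2 (trans (cong (λ k → suc (suc k)) n″≡qm) (ℕP.+-comm 2 (suc q * m))) 3≤m ⟩
      sign n *ℤ blockValue (suc q) 2 ≡⟨ cong (sign n *ℤ_) (blockValue-2 (suc q) (s≤s z≤n)) ⟩
      sign n *ℤ sign (suc q)         ≡⟨ sym (sign-∸ q≤n) ⟩
      sign (n ∸ suc q)               ∎
    where
    open ≡-Reasoning
    n : ℕ
    n = suc (suc n″)
    q≤n : suc q ≤ n
    q≤n = ℕP.≤-trans (subst (suc q ≤_) (sym n″≡qm) (q≤q*m (suc q))) (ℕP.≤-trans (ℕP.n≤1+n n″) (ℕP.n≤1+n (suc n″)))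

  instance
    m-nonZero : NonZero m
    m-nonZero = >-nonZero 1≤m

  -- Translating between n = q m and the theorem's 2n = q (r - 1).
  double : ∀ {x} q → x ≡ q * m → 2 * x ≡ q * (2 * m)
  double {x} q x≡qm = trans (cong (2 *_) x≡qm) (swap q m)
    where
    swap : ∀ q m → 2 * (q * m) ≡ q * (2 * m)
    swap = ℕSolver.solve-∀

  halve : ∀ {x} q → 2 * x ≡ q * (2 * m) → x ≡ q * m
  halve {x} q 2x≡ = ℕP.*-cancelˡ-≡ x (q * m) 2 (trans 2x≡ (sym (double q refl)))

  other : ∀ n → (¬ ∃ λ q → 2 * n ≡ q * (2 * m)) → (¬ ∃ λ q → 2 * (n ∸ 1) ≡ q * (2 * m)) →
          (¬ ∃ λ q → 2 * (n ∸ 2) ≡ q * (2 * m)) → D r n ≡ + 0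
  other n ¬0 ¬1 ¬2 = by-remainder (n % m) (n / m) (trans (m≡m%n+[m/n]*n n m) (ℕP.+-comm (n % m) _)) (m%n<n n m)
    where
    by-remainder : ∀ j q → n ≡ q * m + j → j < m → D r n ≡ + 0
    by-remainder zero                q n≡ _   = ⊥-elim (¬0 (q , double q (trans n≡ (ℕP.+-identityʳ (q * m)))))
    by-remainder (suc zero)          q n≡ _   = ⊥-elim (¬1 (q , double q (trans (cong (_∸ 1) n≡) (ℕP.m+n∸n≡m (q * m) 1))))
    by-remainder (suc (suc zero))    q n≡ _   = ⊥-elim (¬2 (q , double q (trans (cong (_∸ 2) n≡) (ℕP.m+n∸n≡m (q * m) 2))))
    by-remainder j@(suc (suc (suc _))) q n≡ j<m =
      trans (D-block q j n≡ j<m) (trans (cong (sign n *ℤ_) (blockValue-beyond q j (s≤s (s≤s (s≤s z≤n))))) (ℤP.*-zeroʳ (sign n)))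

  large-order : ∀ n → suc (suc m) ≤ n →
      (∀ q → 2 * n ≡ q * (r ∸ 1) → D r n ≡ (- + 1) ^ (n ∸ q))
    × (∀ q → 2 * (n ∸ 1) ≡ q * (r ∸ 1) → D r n ≡ + 2 *ℤ ((- + 1) ^ (n ∸ 1 ∸ q)))
    × (∀ q → 2 * (n ∸ 2) ≡ q * (r ∸ 1) → D r n ≡ (- + 1) ^ (n ∸ q))
    × ((¬ ∃ λ q → 2 * n ≡ q * (r ∸ 1)) → (¬ ∃ λ q → 2 * (n ∸ 1) ≡ q * (r ∸ 1)) →
       (¬ ∃ λ q → 2 * (n ∸ 2) ≡ q * (r ∸ 1)) → D r n ≡ + 0)
  large-order n bound =
      (λ q 2n≡ → multiple q n (halve q 2n≡) bound)
    , (λ q 2n≡ → multiple+1 q n (halve q 2n≡) bound)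
    , (λ q 2n≡ → multiple+2 q n (halve q 2n≡) bound)
    , other n

-- r = 3: from n = 3 on, signedΔ n alternates between ∓ 4, so D 3 n = 4.
module OrderThree where
  open OddOrder 1 ℕP.≤-refl

  signedΔ-0 : signedΔ 0 ≡ + 1
  signedΔ-0 = signedΔ-initial 0 (s≤s z≤n)

  signedΔ-1 : signedΔ 1 ≡ - + 4
  signedΔ-1 = trans (signedΔ-step 0) (cong (λ z → P 1 +ᶻ - z) signedΔ-0)

  signedΔ-2 : signedΔ 2 ≡ + 3
  signedΔ-2 = trans (signedΔ-step 1) (cong (λ z → P 2 +ᶻ - z) signedΔ-1)

  -- Past the degree of P the recurrence only flips signs.
  signedΔ-from-3 : ∀ k → signedΔ (3 + k) ≡ sign k *ℤ (- + 4)
  signedΔ-from-3 zero    = trans (signedΔ-step 2) (cong (λ z → P 3 +ᶻ - z) signedΔ-2)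
  signedΔ-from-3 (suc k) =
    trans (signedΔ-step (3 + k))
          (trans (cong₂ (λ x y → x +ᶻ - y) (P-beyond (4 + k) (s≤s (s≤s (s≤s (s≤s z≤n))))) (signedΔ-from-3 k))
                 (flip (sign k)))
    where
    flip : ∀ s → + 0 +ᶻ - (s *ℤ (- + 4)) ≡ ((- + 1) *ℤ s) *ℤ (- + 4)
    flip = solve-∀

  order-three : ∀ n → 3 ≤ n → D r n ≡ + 4
  order-three zero                ()
  order-three (suc zero)          (s≤s ())
  order-three (suc (suc zero))    (s≤s (s≤s ()))
  order-three (suc (suc (suc k))) _ = begin
      D r (3 + k)                                                ≡⟨ D≡signedΔ (3 + k) ⟩
      sign (3 + k) *ℤ signedΔ (3 + k)                            ≡⟨ cong (sign (3 + k) *ℤ_) (signedΔ-from-3 k) ⟩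
      ((- + 1) *ℤ ((- + 1) *ℤ ((- + 1) *ℤ sign k))) *ℤ (sign k *ℤ (- + 4)) ≡⟨ shape (sign k) ⟩
      (sign k *ℤ sign k) *ℤ + 4                                  ≡⟨ cong (_*ℤ + 4) (sign-square k) ⟩
      + 4                                                        ∎
    where
    open ≡-Reasoning
    shape : ∀ s → ((- + 1) *ℤ ((- + 1) *ℤ ((- + 1) *ℤ s))) *ℤ (s *ℤ (- + 4)) ≡ (s *ℤ s) *ℤ + 4
    shape = solve-∀

sign-even : ∀ k → sign (2 * k) ≡ + 1
sign-even zero    = refl
sign-even (suc k) = trans (cong sign (ℕP.*-suc 2 k)) (trans (double-flip (sign (2 * k))) (sign-even k))
  where
  double-flip : ∀ s → (- + 1) *ℤ ((- + 1) *ℤ s) ≡ s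
  double-flip = solve-∀

-- r = 5: signedΔ vanishes at even n ≥ 4 and alternates between ∓ 2 at odd n ≥ 5.
module OrderFive where
  open OddOrder 2 (s≤s z≤n)

  -- Below, cong is given its implicit arguments wherever signedΔ is applied to concrete
  -- indices: left to unification, the checker would evaluate the determinants themselves.

  signedΔ-even : ∀ k → signedΔ (4 + 2 * k) ≡ + 0
  signedΔ-even zero    = trans (signedΔ-step 2) (cong (λ z → P 4 +ᶻ - z)
                           (trans (signedΔ-step 0) (cong (λ z → P 2 +ᶻ - z) (signedΔ-initial 0 (s≤s z≤n)))))
  signedΔ-even (suc k) = begin
      signedΔ (4 + 2 * suc k)                     ≡⟨ cong signedΔ {4 + 2 * suc k} {2 + (4 + 2 * k)} (two-more k) ⟩
      signedΔ (2 + (4 + 2 * k))                   ≡⟨ signedΔ-step (4 + 2 * k) ⟩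
      P (6 + 2 * k) +ᶻ - signedΔ (4 + 2 * k)      ≡⟨ cong₂ (λ x y → x +ᶻ - y) (P-beyond (6 + 2 * k) (ℕP.m≤m+n 6 (2 * k))) (signedΔ-even k) ⟩
      + 0                                         ∎
    where
    open ≡-Reasoning
    two-more : ∀ k → 4 + 2 * suc k ≡ 2 + (4 + 2 * k)
    two-more = ℕSolver.solve-∀

  signedΔ-odd : ∀ k → signedΔ (5 + 2 * k) ≡ sign k *ℤ (- + 2)
  signedΔ-odd zero    = trans (signedΔ-step 3) (cong (λ z → P 5 +ᶻ - z)
                          (trans (signedΔ-step 1) (cong (λ z → P 3 +ᶻ - z) (signedΔ-initial 1 (s≤s (s≤s z≤n))))))
  signedΔ-odd (suc k) = begin
      signedΔ (5 + 2 * suc k)                     ≡⟨ cong signedΔ {5 + 2 * suc k} {2 + (5 + 2 * k)} (two-more k) ⟩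
      signedΔ (2 + (5 + 2 * k))                   ≡⟨ signedΔ-step (5 + 2 * k) ⟩
      P (7 + 2 * k) +ᶻ - signedΔ (5 + 2 * k)      ≡⟨ cong₂ (λ x y → x +ᶻ - y) (P-beyond (7 + 2 * k) (ℕP.≤-trans (ℕP.n≤1+n 6) (ℕP.m≤m+n 7 (2 * k)))) (signedΔ-odd k) ⟩
      + 0 +ᶻ - (sign k *ℤ (- + 2))                ≡⟨ flip (sign k) ⟩
      sign (suc k) *ℤ (- + 2)                     ∎
    where
    open ≡-Reasoning
    two-more : ∀ k → 5 + 2 * suc k ≡ 2 + (5 + 2 * k)
    two-more = ℕSolver.solve-∀
    flip : ∀ s → + 0 +ᶻ - (s *ℤ (- + 2)) ≡ ((- + 1) *ℤ s) *ℤ (- + 2)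
    flip = solve-∀

  order-five-even : ∀ k n → n ≡ 2 * k → 4 ≤ n → D r n ≡ + 0
  order-five-even zero          .0 refl ()
  order-five-even (suc zero)    .2 refl (s≤s (s≤s ()))
  order-five-even (suc (suc k)) n n≡2k _ = begin
      D r n                        ≡⟨ D≡signedΔ n ⟩
      sign n *ℤ signedΔ n          ≡⟨ cong (λ i → sign n *ℤ signedΔ i) {n} {4 + 2 * k} n≡4+2k ⟩
      sign n *ℤ signedΔ (4 + 2 * k) ≡⟨ cong (sign n *ℤ_) {signedΔ (4 + 2 * k)} {+ 0} (signedΔ-even k) ⟩
      sign n *ℤ + 0                ≡⟨ ℤP.*-zeroʳ (sign n) ⟩
      + 0                          ∎
    where
    open ≡-Reasoning
    n≡4+2k : n ≡ 4 + 2 * k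
    n≡4+2k = trans n≡2k (ℕP.*-distribˡ-+ 2 2 k)

  order-five-odd : ∀ k n → n ≡ 2 * k + 1 → 4 ≤ n → D r n ≡ + 2 *ℤ sign k
  order-five-odd zero          .1 refl (s≤s ())
  order-five-odd (suc zero)    .3 refl (s≤s (s≤s (s≤s ())))
  order-five-odd (suc (suc k)) n n≡2k+1 _ = begin
      D r n                                       ≡⟨ D≡signedΔ n ⟩
      sign n *ℤ signedΔ n                         ≡⟨ cong (λ i → sign i *ℤ signedΔ i) {n} {5 + 2 * k} n≡5+2k ⟩
      sign (5 + 2 * k) *ℤ signedΔ (5 + 2 * k)     ≡⟨ cong (sign (5 + 2 * k) *ℤ_) {signedΔ (5 + 2 * k)} {sign k *ℤ (- + 2)} (signedΔ-odd k) ⟩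
      sign (5 + 2 * k) *ℤ (sign k *ℤ (- + 2))     ≡⟨ cong (λ e → (- + 1) *ℤ ((- + 1) *ℤ ((- + 1) *ℤ ((- + 1) *ℤ ((- + 1) *ℤ e))))
                                                                 *ℤ (sign k *ℤ (- + 2))) {sign (2 * k)} {+ 1} (sign-even k) ⟩
      (- + 1) *ℤ ((- + 1) *ℤ ((- + 1) *ℤ ((- + 1) *ℤ ((- + 1) *ℤ + 1)))) *ℤ (sign k *ℤ (- + 2))
                                                  ≡⟨ shape (sign k) ⟩
      + 2 *ℤ sign (suc (suc k))                   ∎
    where
    open ≡-Reasoning
    n≡5+2k : n ≡ 5 + 2 * k
    n≡5+2k = trans n≡2k+1 (rearrange k)
      where
      rearrange : ∀ k → 2 * suc (suc k) + 1 ≡ 5 + 2 * k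
      rearrange = ℕSolver.solve-∀
    shape : ∀ s → (- + 1) *ℤ ((- + 1) *ℤ ((- + 1) *ℤ ((- + 1) *ℤ ((- + 1) *ℤ + 1)))) *ℤ (s *ℤ (- + 2))
                  ≡ + 2 *ℤ ((- + 1) *ℤ ((- + 1) *ℤ s))
    shape = solve-∀

halve-bound : ∀ m n → suc (2 * m) + 3 ≤ 2 * n → suc (suc m) ≤ n
halve-bound m n r+3≤2n = ℕP.*-cancelˡ-≤ 2 (subst (_≤ 2 * n) (rearrange m) r+3≤2n)
  where
  rearrange : ∀ m → suc (2 * m) + 3 ≡ 2 * suc (suc m)
  rearrange = ℕSolver.solve-∀

odd-form : ∀ r → r % 2 ≡ 1 → r ≡ suc (2 * (r / 2))
odd-form r odd = trans (m≡m%n+[m/n]*n r 2) (trans (cong (_+ r / 2 * 2) odd) (cong suc (ℕP.*-comm (r / 2) 2)))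

theorem9 : (r n : ℕ) → r % 2 ≡ 1 → 3 ≤ r → r + 3 ≤ 2 * n →
    ((7 ≤ r →
        (∀ q → 2 * n ≡ q * (r ∸ 1) → D r n ≡ (- + 1) ^ (n ∸ q))
      × (∀ q → 2 * (n ∸ 1) ≡ q * (r ∸ 1) → D r n ≡ + 2 *ℤ ((- + 1) ^ (n ∸ 1 ∸ q)))
      × (∀ q → 2 * (n ∸ 2) ≡ q * (r ∸ 1) → D r n ≡ (- + 1) ^ (n ∸ q))
      × ((¬ ∃ λ q → 2 * n ≡ q * (r ∸ 1)) → (¬ ∃ λ q → 2 * (n ∸ 1) ≡ q * (r ∸ 1)) →
         (¬ ∃ λ q → 2 * (n ∸ 2) ≡ q * (r ∸ 1)) → D r n ≡ + 0))
    × (r ≡ 5 →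
        (∀ k → n ≡ 2 * k → D r n ≡ + 0)
      × (∀ k → n ≡ 2 * k + 1 → D r n ≡ + 2 *ℤ ((- + 1) ^ k)))
    × (r ≡ 3 → D r n ≡ + 4))
theorem9 r n odd 3≤r bound with r / 2 | odd-form r odd
... | zero | refl = ⊥-elim (ℕP.<⇒≱ (s≤s (s≤s z≤n)) 3≤r)
... | suc zero | refl =
    (λ { (s≤s (s≤s (s≤s ()))) })
  , (λ ())
  , (λ _ → OrderThree.order-three n (halve-bound 1 n bound))
... | suc (suc zero) | refl =
    (λ { (s≤s (s≤s (s≤s (s≤s (s≤s ()))))) })
  , (λ _ → (λ k n≡2k → OrderFive.order-five-even k n n≡2k (halve-bound 2 n bound))
         , (λ k n≡2k+1 → OrderFive.order-five-odd k n n≡2k+1 (halve-bound 2 n bound)))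
  , (λ ())
... | m@(suc (suc (suc _))) | refl =
    (λ _ → LargeOrder.large-order m 3≤m n (halve-bound m n bound))
  , (λ r≡5 → ⊥-elim (ℕP.<⇒≢ (ℕP.≤-trans (ℕP.n≤1+n 6) 7≤r) (sym r≡5)))
  , (λ r≡3 → ⊥-elim (ℕP.<⇒≢ (ℕP.≤-trans (ℕP.m≤m+n 4 3) 7≤r) (sym r≡3)))
  where
  3≤m : 3 ≤ m
  3≤m = s≤s (s≤s (s≤s z≤n))
  7≤r : 7 ≤ suc (2 * m)
  7≤r = s≤s (ℕP.*-monoʳ-≤ 2 3≤m)
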